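{- Let $n \ge k \ge 2$ be integers. Then $1 - 2^{\binom{k}{2}-1}$ is a root of $Q_{n,k}$ if and only if $n \ge R(k)$.
   Context: $[n]=\{1,\dots,n\}$; $\binom{S}{j}$ is the set of $j$-element subsets of $S$. Let $\mathcal{B}$ be the set of assignments $\mathfrak{h}$ which associate to each $S\in\binom{[n]}{k}$ a finite simple undirected graph $\mathfrak{h}_S$ on vertex set $S$ such that (i) for every $S$, $|\mathbf{E}(\mathfrak{h}_S)|$ is even, and (ii) for every $e\in\binom{[n]}{2}$, the number of $S\in\binom{[n]}{k}$ with $e\in\mathbf{E}(\mathfrak{h}_S)$ is even. For $\mathfrak{h}\in\mathcal{B}$, $\mathrm{Empty}(\mathfrak{h}) := \{S\in\binom{[n]}{k} : \mathfrak{h}_S \text{ has no edges}\}$. Define $Q_{n,k}(t) := \sum_{\mathfrak{h}\in\mathcal{B}} t^{|\mathrm{Empty}(\mathfrak{h})|}\in\mathbb{Z}[t]$. The $k$-th diagonal Ramsey number $R(k)$ is the least positive integer $n$ such that every graph on $n$ vertices contains a clique of size $k$ or an independent set of size $k$. -}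

module Defs where

open import Data.Nat as ℕ using (ℕ; zero; suc; _≤_; _∸_)
open import Data.Nat.Divisibility using (_∣_; _∣?_)
open import Data.Nat.Combinatorics using (_C_)
open import Data.Integer as ℤ using (ℤ; 1ℤ; 0ℤ; +_)
open import Data.Bool using (Bool; true; false)
import Data.Bool as Bool
open import Data.Fin using (Fin)
open import Data.Fin.Subset using (Subset; inside; outside; ∣_∣; _∈_; _⊆_)
open import Data.Fin.Subset.Properties using (_⊆?_)
open import Data.Vec using (Vec; []; _∷_)
open import Data.Vec.Properties using (≡-dec)
open import Data.List using (List; []; _∷_; map; _++_; concatMap; filter; length; sum)
open import Data.List.Membership.Propositional using () renaming (_∈_ to _∈ˡ_)
open import Data.List.Membership.DecPropositional using () renaming (_∈?_ to ∈?-dec)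
open import Data.List.Relation.Unary.All using (All; all?)
open import Data.Product using (_×_; _,_; proj₁; proj₂; Σ; ∃)
open import Data.Product.Relation.Unary.All using () 
open import Relation.Nullary using (¬_; Dec; yes; no)
open import Relation.Nullary.Decidable using (_×-dec_; ¬?)
open import Relation.Binary.PropositionalEquality using (_≡_; _≢_)
open import Data.Nat.Properties using (_≟_)

allSubsets : (n : ℕ) → List (Subset n)
allSubsets zero    = [] ∷ []
allSubsets (suc n) = map (outside ∷_) (allSubsets n) ++ map (inside ∷_) (allSubsets n)

_≟ˢ_ : ∀ {n} (A B : Subset n) → Dec (A ≡ B)
_≟ˢ_ = ≡-dec Bool._≟_

choose : (n j : ℕ) → List (Subset n)
choose n j = filter (λ S → ∣ S ∣ ≟ j) (allSubsets n)

sublists : ∀ {a} {A : Set a} → List A → List (List A)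
sublists []       = [] ∷ []
sublists (x ∷ xs) = sublists xs ++ map (x ∷_) (sublists xs)

pairsIn : ∀ {n} → Subset n → List (Subset n)
pairsIn {n} S = filter (λ e → e ⊆? S) (choose n 2)

-- A finite simple graph on vertex set S, given by its edge set
-- (a list of 2-subsets of S, without repetition).  All of them:
graphsOn : ∀ {n} → Subset n → List (List (Subset n))
graphsOn S = sublists (pairsIn S)

-- An assignment h : S ↦ h_S, recorded as the list of pairs (S , E(h_S))
-- for S ranging over binom([n], k) (in the fixed enumeration order).
Assignment : ℕ → Set
Assignment n = List (Subset n × List (Subset n))

assignmentsOver : ∀ {n} → List (Subset n) → List (Assignment n)
assignmentsOver []       = [] ∷ []
assignmentsOver (S ∷ Ss) =
  concatMap (λ g → map ((S , g) ∷_) (assignmentsOver Ss)) (graphsOn S)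

assignments : (n k : ℕ) → List (Assignment n)
assignments n k = assignmentsOver (choose n k)

Even : ℕ → Set
Even m = 2 ∣ m

countContaining : ∀ {n} → Subset n → Assignment n → ℕ
countContaining e h = length (filter (λ p → ∈?-dec _≟ˢ_ e (proj₂ p)) h)

InB : ∀ {n} → Assignment n → Set
InB {n} h = All (λ p → Even (length (proj₂ p))) h
          × All (λ e → Even (countContaining e h)) (choose n 2)

InB? : ∀ {n} (h : Assignment n) → Dec (InB h)
InB? {n} h = all? (λ p → 2 ∣? length (proj₂ p)) h
         ×-dec all? (λ e → 2 ∣? countContaining e h) (choose n 2)

𝓑 : (n k : ℕ) → List (Assignment n)
𝓑 n k = filter InB? (assignments n k)

emptyCount : ∀ {n} → Assignment n → ℕ
emptyCount h = length (filter (λ p → length (proj₂ p) ≟ 0) h)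

Q : (n k : ℕ) → ℤ → ℤ
Q n k t = Data.List.foldr ℤ._+_ 0ℤ (map (λ h → t ℤ.^ emptyCount h) (𝓑 n k))

record Graph (m : ℕ) : Set where
  field
    adj   : Fin m → Fin m → Bool
    sym   : ∀ i j → adj i j ≡ adj j i
    irrefl : ∀ i → adj i i ≡ false

Homogeneous : ∀ {m} → Graph m → Bool → Subset m → Set
Homogeneous G b S = ∀ i j → i ∈ S → j ∈ S → i ≢ j → Graph.adj G i j ≡ b

RamseyProperty : ℕ → ℕ → Set
RamseyProperty k m = ∀ (G : Graph m) →
  ∃ λ (b : Bool) → ∃ λ (S : Subset m) → ∣ S ∣ ≡ k × Homogeneous G b S

IsRamseyNumber : ℕ → ℕ → Set
IsRamseyNumber k r = 1 ≤ r × RamseyProperty k r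
                   × (∀ m → 1 ≤ m → RamseyProperty k m → r ≤ m)

-- Each parity condition (ii) defining 𝓑 is an indicator [2 ∣ m] = (1 + (-1)^m) / 2.  Expanding their
-- product over all pairs e turns 2^|E| Q(t) into a sum over edge sets G ⊆ E, read as 2-colourings of
-- K_n, of products over the k-sets S of independent block sums
--   Σ_{g ⊆ pairs of S} [2 ∣ |g|] t^[g = ∅] (-1)^|G ∩ g|.
-- Expanding [2 ∣ |g|] the same way makes the block sum a character sum over the subsets of the C(k,2)
-- pairs of S; it equals (t - 1) + 2^(C(k,2)-1) [S is monochromatic under G].  At t = 1 - 2^(C(k,2)-1)
-- it becomes -2^(C(k,2)-1) [S is not monochromatic], so Q vanishes there iff no 2-colouring of K_n
-- avoids monochromatic k-sets, i.e. iff n ≥ R(k).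

module Submission where

open import Defs
open import Data.Nat using (ℕ; _≤_; _∸_)
open import Data.Nat.Combinatorics using (_C_)
open import Data.Integer using (ℤ; 1ℤ; 0ℤ; +_; _-_; _^_)
open import Function.Bundles using (_⇔_)
open import Relation.Binary.PropositionalEquality using (_≡_)

open import Data.Nat as ℕ using (zero; suc; s≤s; z≤n)
import Data.Nat.Properties as ℕ
open import Data.Nat.Combinatorics using (nC1≡n; nCk+nC[k+1]≡[n+1]C[k+1])
open import Data.Nat.Divisibility using (_∣_; _∣?_; ∣m+n∣m⇒∣n; ∣m∣n⇒∣m+n; ∣-refl)
open import Data.Integer using (-1ℤ; _+_; _*_; -_)
import Data.Integer.Properties as ℤ
open import Data.Integer.Tactic.RingSolver using (solve-∀)
open import Data.Bool using (Bool; true; false; _xor_; if_then_else_)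
import Data.Bool as Bool
open import Data.Fin as Fin using (Fin)
import Data.Fin.Properties as Fin
open import Data.Fin.Subset using (Subset; inside; outside; ⁅_⁆; _∪_; _∈_; _⊆_; ∣_∣; ⊥)
open import Data.Fin.Subset.Properties using (_⊆?_)
import Data.Fin.Subset.Properties as Subsetₚ
open import Data.Vec using ([]; _∷_)
import Data.Vec as Vec
open import Data.List using (List; []; _∷_; _++_; map; filter; foldr; length; concatMap)
import Data.List.Properties as List
open import Data.List.Membership.Propositional using (find; lose) renaming (_∈_ to _∈ˡ_; _∉_ to _∉ˡ_)
open import Data.List.Membership.Propositional.Properties
  using (∈-++⁻; ∈-map⁻; ∈-map⁺; ∈-++⁺ˡ; ∈-++⁺ʳ; ∈-filter⁺; ∈-filter⁻)
open import Data.List.Membership.DecPropositional using () renaming (_∈?_ to ∈?-dec)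
open import Data.List.Relation.Unary.All using (All; []; _∷_; all?)
import Data.List.Relation.Unary.All as All
import Data.List.Relation.Unary.All.Properties as All
open import Data.List.Relation.Unary.Any as Any using (Any; here; there)
open import Data.List.Relation.Unary.AllPairs using ([]; _∷_)
open import Data.List.Relation.Unary.Unique.Propositional using (Unique)
import Data.List.Relation.Unary.Unique.Propositional.Properties as Unique
open import Data.Product using (_×_; _,_; ∃; ∃₂; ∃-syntax; proj₁; proj₂)
open import Data.Sum using (_⊎_; inj₁; inj₂)
open import Function using (_∘_)
open import Function.Bundles using (mk⇔)
open import Function.Properties.Equivalence using (⇔-setoid)
open import Level using (0ℓ)
open import Relation.Nullary using (Dec; yes; no; does; ¬_; contradiction)
open import Relation.Nullary.Decidable using (dec-true; dec-false; map′; _×-dec_; _⊎-dec_; ¬?; decidable-stable)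
open import Relation.Unary using (Pred; Decidable)
open import Relation.Binary.PropositionalEquality
  using (_≢_; refl; sym; trans; cong; cong₂; _≗_; module ≡-Reasoning)
import Relation.Binary.Reasoning.Setoid as SetoidReasoning

-- Sums and products over lists

-- foldr ∘ map, so that Q n k t is definitionally ∑[ h ∈ 𝓑 n k ] (t ^ emptyCount h).
∑ ∏ : ∀ {a} {A : Set a} → List A → (A → ℤ) → ℤ
∑ xs f = foldr _+_ 0ℤ (map f xs)
∏ xs f = foldr _*_ 1ℤ (map f xs)

infix 10 ∑ ∏
syntax ∑ xs (λ x → e) = ∑[ x ∈ xs ] e
syntax ∏ xs (λ x → e) = ∏[ x ∈ xs ] e

module _ {a} {A : Set a} where

  ∑-cong-∈ : ∀ xs {f g : A → ℤ} → (∀ {x} → x ∈ˡ xs → f x ≡ g x) → ∑ xs f ≡ ∑ xs g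
  ∑-cong-∈ []       f≡g = refl
  ∑-cong-∈ (x ∷ xs) f≡g = cong₂ _+_ (f≡g (here refl)) (∑-cong-∈ xs (f≡g ∘ there))

  ∏-cong-∈ : ∀ xs {f g : A → ℤ} → (∀ {x} → x ∈ˡ xs → f x ≡ g x) → ∏ xs f ≡ ∏ xs g
  ∏-cong-∈ []       f≡g = refl
  ∏-cong-∈ (x ∷ xs) f≡g = cong₂ _*_ (f≡g (here refl)) (∏-cong-∈ xs (f≡g ∘ there))

  ∑-cong : ∀ xs {f g : A → ℤ} → f ≗ g → ∑ xs f ≡ ∑ xs g
  ∑-cong xs f≗g = ∑-cong-∈ xs (λ {x} _ → f≗g x)

  ∏-cong : ∀ xs {f g : A → ℤ} → f ≗ g → ∏ xs f ≡ ∏ xs g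
  ∏-cong xs f≗g = ∏-cong-∈ xs (λ {x} _ → f≗g x)

  ∑-++ : ∀ xs ys (f : A → ℤ) → ∑ (xs ++ ys) f ≡ ∑ xs f + ∑ ys f
  ∑-++ []       ys f = sym (ℤ.+-identityˡ _)
  ∑-++ (x ∷ xs) ys f = trans (cong (_+_ (f x)) (∑-++ xs ys f)) (sym (ℤ.+-assoc (f x) _ _))

  ∑-zero : (xs : List A) → ∑[ x ∈ xs ] 0ℤ ≡ 0ℤ
  ∑-zero []       = refl
  ∑-zero (x ∷ xs) = trans (ℤ.+-identityˡ _) (∑-zero xs)

  ∏-one : (xs : List A) → ∏[ x ∈ xs ] 1ℤ ≡ 1ℤ
  ∏-one []       = refl
  ∏-one (x ∷ xs) = trans (ℤ.*-identityˡ _) (∏-one xs)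

  ∏-const : ∀ c (xs : List A) → ∏[ x ∈ xs ] c ≡ c ^ length xs
  ∏-const c []       = refl
  ∏-const c (x ∷ xs) = cong (c *_) (∏-const c xs)

  ∑-distrib-+ : ∀ xs (f g : A → ℤ) → ∑[ x ∈ xs ] (f x + g x) ≡ ∑ xs f + ∑ xs g
  ∑-distrib-+ []       f g = refl
  ∑-distrib-+ (x ∷ xs) f g = trans (cong (_+_ (f x + g x)) (∑-distrib-+ xs f g))
                                   (interchange (f x) (g x) (∑ xs f) (∑ xs g))
    where
    interchange : ∀ a b c d → a + b + (c + d) ≡ a + c + (b + d)
    interchange = solve-∀

  ∏-distrib-* : ∀ xs (f g : A → ℤ) → ∏[ x ∈ xs ] (f x * g x) ≡ ∏ xs f * ∏ xs g
  ∏-distrib-* []       f g = refl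
  ∏-distrib-* (x ∷ xs) f g = trans (cong (f x * g x *_) (∏-distrib-* xs f g))
                                   (interchange (f x) (g x) (∏ xs f) (∏ xs g))
    where
    interchange : ∀ a b c d → a * b * (c * d) ≡ a * c * (b * d)
    interchange = solve-∀

  *-distribˡ-∑ : ∀ c xs (f : A → ℤ) → c * ∑ xs f ≡ ∑[ x ∈ xs ] (c * f x)
  *-distribˡ-∑ c []       f = ℤ.*-zeroʳ c
  *-distribˡ-∑ c (x ∷ xs) f = trans (ℤ.*-distribˡ-+ c (f x) _) (cong (_+_ (c * f x)) (*-distribˡ-∑ c xs f))

  *-distribʳ-∑ : ∀ c xs (f : A → ℤ) → ∑ xs f * c ≡ ∑[ x ∈ xs ] (f x * c)
  *-distribʳ-∑ c xs f = trans (ℤ.*-comm (∑ xs f) c)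
                              (trans (*-distribˡ-∑ c xs f) (∑-cong xs (λ x → ℤ.*-comm c (f x))))

  ∏-scale : ∀ c xs (f : A → ℤ) → ∏[ x ∈ xs ] (c * f x) ≡ c ^ length xs * ∏ xs f
  ∏-scale c xs f = trans (∏-distrib-* xs (λ _ → c) f) (cong (_* ∏ xs f) (∏-const c xs))

module _ {a b} {A : Set a} {B : Set b} where

  ∑-map : ∀ (g : A → B) xs (f : B → ℤ) → ∑ (map g xs) f ≡ ∑ xs (f ∘ g)
  ∑-map g []       f = refl
  ∑-map g (x ∷ xs) f = cong (_+_ (f (g x))) (∑-map g xs f)

  ∑-concatMap : ∀ (g : A → List B) xs (f : B → ℤ) → ∑ (concatMap g xs) f ≡ ∑[ x ∈ xs ] ∑ (g x) f
  ∑-concatMap g []       f = refl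
  ∑-concatMap g (x ∷ xs) f = trans (∑-++ (g x) (concatMap g xs) f)
                                   (cong (_+_ (∑ (g x) f)) (∑-concatMap g xs f))

  ∑-comm : ∀ xs ys (f : A → B → ℤ) → ∑[ x ∈ xs ] ∑ ys (f x) ≡ ∑[ y ∈ ys ] ∑[ x ∈ xs ] f x y
  ∑-comm []       ys f = sym (∑-zero ys)
  ∑-comm (x ∷ xs) ys f = trans (cong (_+_ (∑ ys (f x))) (∑-comm xs ys f))
                               (sym (∑-distrib-+ ys (f x) (λ y → ∑[ x ∈ xs ] f x y)))

  ∏-comm : ∀ xs ys (f : A → B → ℤ) → ∏[ x ∈ xs ] ∏ ys (f x) ≡ ∏[ y ∈ ys ] ∏[ x ∈ xs ] f x y
  ∏-comm []       ys f = sym (∏-one ys)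
  ∏-comm (x ∷ xs) ys f = trans (cong (∏ ys (f x) *_) (∏-comm xs ys f))
                               (sym (∏-distrib-* ys (f x) (λ y → ∏[ x ∈ xs ] f x y)))

≡0-transfer : ∀ {a b x y : ℤ} → b ≢ 0ℤ → a * x ≡ b * y → x ≡ 0ℤ → y ≡ 0ℤ
≡0-transfer {a} {b} b≢0 ax≡by refl with ℤ.i*j≡0⇒i≡0∨j≡0 b (trans (sym ax≡by) (ℤ.*-zeroʳ a))
... | inj₁ b≡0 = contradiction b≡0 b≢0
... | inj₂ y≡0 = y≡0

*≡*⇒≡0⇔≡0 : ∀ {a b x y : ℤ} → a ≢ 0ℤ → b ≢ 0ℤ → a * x ≡ b * y → (x ≡ 0ℤ) ⇔ (y ≡ 0ℤ)
*≡*⇒≡0⇔≡0 {a} {b} a≢0 b≢0 ax≡by =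
  mk⇔ (≡0-transfer {a} b≢0 ax≡by) (≡0-transfer {b} a≢0 (sym ax≡by))

*≢0 : ∀ {i j} → i ≢ 0ℤ → j ≢ 0ℤ → i * j ≢ 0ℤ
*≢0 {i} i≢0 j≢0 ij≡0 with ℤ.i*j≡0⇒i≡0∨j≡0 i ij≡0
... | inj₁ i≡0 = i≢0 i≡0
... | inj₂ j≡0 = j≢0 j≡0

^≢0 : ∀ {i} n → i ≢ 0ℤ → i ^ n ≢ 0ℤ
^≢0 n i≢0 = i≢0 ∘ ℤ.i^n≡0⇒i≡0 _ n

-≢0 : ∀ {i} → i ≢ 0ℤ → - i ≢ 0ℤ
-≢0 i≢0 = i≢0 ∘ ℤ.neg-injective

2≢0 : + 2 ≢ 0ℤ
2≢0 ()

-- Iverson brackets, signs and parity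

infixr 8 _^ᵇ_
_^ᵇ_ : ℤ → Bool → ℤ
t ^ᵇ false = 1ℤ
t ^ᵇ true  = t

⟦_⟧ : ∀ {p} {P : Set p} → Dec P → ℤ
⟦ P? ⟧ = if does P? then 1ℤ else 0ℤ

module _ {p q} {P : Set p} {Q : Set q} where

  ⟦⟧-cong : (P → Q) → (Q → P) → (P? : Dec P) (Q? : Dec Q) → ⟦ P? ⟧ ≡ ⟦ Q? ⟧
  ⟦⟧-cong P→Q Q→P (yes p) (yes q) = refl
  ⟦⟧-cong P→Q Q→P (yes p) (no ¬q) = contradiction (P→Q p) ¬q
  ⟦⟧-cong P→Q Q→P (no ¬p) (yes q) = contradiction (Q→P q) ¬p
  ⟦⟧-cong P→Q Q→P (no ¬p) (no ¬q) = refl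

  ⟦×-dec⟧ : (P? : Dec P) (Q? : Dec Q) → ⟦ P? ×-dec Q? ⟧ ≡ ⟦ P? ⟧ * ⟦ Q? ⟧
  ⟦×-dec⟧ P? Q? with does P? | does Q?
  ... | true  | true  = refl
  ... | true  | false = refl
  ... | false | _     = refl

module _ {a p} {A : Set a} {P : Pred A p} (P? : Decidable P) where

  ⟦all?⟧ : ∀ xs → ⟦ all? P? xs ⟧ ≡ ∏[ x ∈ xs ] ⟦ P? x ⟧
  ⟦all?⟧ []       = refl
  ⟦all?⟧ (x ∷ xs) = trans (⟦×-dec⟧ (P? x) (all? P? xs)) (cong (⟦ P? x ⟧ *_) (⟦all?⟧ xs))

  ∑-filter : ∀ xs (f : A → ℤ) → ∑ (filter P? xs) f ≡ ∑[ x ∈ xs ] (⟦ P? x ⟧ * f x)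
  ∑-filter []       f = refl
  ∑-filter (x ∷ xs) f with does (P? x)
  ... | true  = cong₂ _+_ (sym (ℤ.*-identityˡ (f x))) (∑-filter xs f)
  ... | false = trans (∑-filter xs f) (sym (ℤ.+-identityˡ _))

  ∑⟦⟧≡length-filter : ∀ xs → ∑[ x ∈ xs ] ⟦ P? x ⟧ ≡ + length (filter P? xs)
  ∑⟦⟧≡length-filter []       = refl
  ∑⟦⟧≡length-filter (x ∷ xs) with does (P? x)
  ... | true  = cong (_+_ 1ℤ) (∑⟦⟧≡length-filter xs)
  ... | false = trans (ℤ.+-identityˡ _) (∑⟦⟧≡length-filter xs)

  ^-length-filter : ∀ t xs → t ^ length (filter P? xs) ≡ ∏[ x ∈ xs ] (t ^ᵇ does (P? x))
  ^-length-filter t []       = refl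
  ^-length-filter t (x ∷ xs) with does (P? x)
  ... | true  = cong (t *_) (^-length-filter t xs)
  ... | false = trans (^-length-filter t xs) (sym (ℤ.*-identityˡ _))

⟦¬⊎⟧ : ∀ {p q} {P : Set p} {Q : Set q} (P? : Dec P) (Q? : Dec Q) → ¬ (P × Q) →
       1ℤ - (⟦ P? ⟧ + ⟦ Q? ⟧) ≡ ⟦ ¬? (P? ⊎-dec Q?) ⟧
⟦¬⊎⟧ (yes p) (yes q) ¬p×q = contradiction (p , q) ¬p×q
⟦¬⊎⟧ (yes p) (no ¬q) ¬p×q = refl
⟦¬⊎⟧ (no ¬p) (yes q) ¬p×q = refl
⟦¬⊎⟧ (no ¬p) (no ¬q) ¬p×q = refl

∑⟦⟧≡0⇔All¬ : ∀ {a p} {A : Set a} {P : Pred A p} (P? : Decidable P) xs →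
             (∑[ x ∈ xs ] ⟦ P? x ⟧ ≡ 0ℤ) ⇔ All (¬_ ∘ P) xs
∑⟦⟧≡0⇔All¬ P? xs = mk⇔ ∑≡0⇒none none⇒∑≡0
  where
  ∑≡0⇒none : ∑[ x ∈ xs ] ⟦ P? x ⟧ ≡ 0ℤ → All (¬_ ∘ _) xs
  ∑≡0⇒none ∑≡0 = All.tabulate λ x∈ Px → ℕ.<⇒≢ (List.filter-some P? (lose x∈ Px)) (sym ∣filter∣≡0)
    where
    ∣filter∣≡0 : length (filter P? xs) ≡ 0
    ∣filter∣≡0 = ℤ.+-injective (trans (sym (∑⟦⟧≡length-filter P? xs)) ∑≡0)
  none⇒∑≡0 : All (¬_ ∘ _) xs → ∑[ x ∈ xs ] ⟦ P? x ⟧ ≡ 0ℤ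
  none⇒∑≡0 ¬Ps = trans (∑⟦⟧≡length-filter P? xs) (cong (+_ ∘ length) (List.filter-none P? ¬Ps))

-1^ᵇ-xor : ∀ a b → -1ℤ ^ᵇ (a xor b) ≡ -1ℤ ^ᵇ a * -1ℤ ^ᵇ b
-1^ᵇ-xor true  true  = refl
-1^ᵇ-xor true  false = refl
-1^ᵇ-xor false true  = refl
-1^ᵇ-xor false false = refl

1+-1^ᵇ*-1^ᵇ : ∀ a b → 1ℤ + -1ℤ ^ᵇ a * -1ℤ ^ᵇ b ≡ + 2 * ⟦ b Bool.≟ a ⟧
1+-1^ᵇ*-1^ᵇ true  true  = refl
1+-1^ᵇ*-1^ᵇ true  false = refl
1+-1^ᵇ*-1^ᵇ false true  = refl
1+-1^ᵇ*-1^ᵇ false false = refl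

2⟦2∣m⟧≡1+-1^m : ∀ m → + 2 * ⟦ 2 ∣? m ⟧ ≡ 1ℤ + -1ℤ ^ m
2⟦2∣m⟧≡1+-1^m 0 = refl
2⟦2∣m⟧≡1+-1^m 1 = refl
2⟦2∣m⟧≡1+-1^m (suc (suc m)) = begin
  + 2 * ⟦ 2 ∣? suc (suc m) ⟧  ≡⟨ cong (+ 2 *_) ⟦2∣2+m⟧≡⟦2∣m⟧ ⟩
  + 2 * ⟦ 2 ∣? m ⟧            ≡⟨ 2⟦2∣m⟧≡1+-1^m m ⟩
  1ℤ + -1ℤ ^ m                ≡⟨ -1*-1*x (-1ℤ ^ m) ⟩
  1ℤ + -1ℤ * (-1ℤ * -1ℤ ^ m)  ∎
  where
  open ≡-Reasoning
  2∣2+m⇒2∣m : 2 ∣ 2 ℕ.+ m → 2 ∣ m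
  2∣2+m⇒2∣m 2∣2+m = ∣m+n∣m⇒∣n 2∣2+m ∣-refl
  ⟦2∣2+m⟧≡⟦2∣m⟧ : ⟦ 2 ∣? suc (suc m) ⟧ ≡ ⟦ 2 ∣? m ⟧
  ⟦2∣2+m⟧≡⟦2∣m⟧ = ⟦⟧-cong 2∣2+m⇒2∣m (∣m∣n⇒∣m+n ∣-refl) (2 ∣? suc (suc m)) (2 ∣? m)
  -1*-1*x : ∀ x → 1ℤ + x ≡ 1ℤ + -1ℤ * (-1ℤ * x)
  -1*-1*x = solve-∀

-- Sums over sublists

module _ {a} {A : Set a} where

  ∈-sublists⇒⊆ : ∀ {xs g : List A} {y} → g ∈ˡ sublists xs → y ∈ˡ g → y ∈ˡ xs
  ∈-sublists⇒⊆ {[]}     (here refl) ()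
  ∈-sublists⇒⊆ {x ∷ xs} g∈ y∈g with ∈-++⁻ (sublists xs) g∈
  ... | inj₁ g∈xs = there (∈-sublists⇒⊆ g∈xs y∈g)
  ... | inj₂ x∷g∈ with ∈-map⁻ (x ∷_) x∷g∈
  ...   | g , g∈xs , refl with y∈g
  ...     | here y≡x  = here y≡x
  ...     | there y∈g = there (∈-sublists⇒⊆ g∈xs y∈g)

  ∑-sublists-multiplicative : (F : List A → ℤ) (w : A → ℤ) → F [] ≡ 1ℤ →
    (∀ {x g} → x ∉ˡ g → F (x ∷ g) ≡ w x * F g) →
    ∀ {xs} → Unique xs → ∑ (sublists xs) F ≡ ∏[ x ∈ xs ] (1ℤ + w x)
  ∑-sublists-multiplicative F w F[]≡1 F-∷ {[]}     _ = trans (ℤ.+-identityʳ _) F[]≡1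
  ∑-sublists-multiplicative F w F[]≡1 F-∷ {x ∷ xs} (x∉xs ∷ xs!) = begin
    ∑ (sublists xs ++ map (x ∷_) (sublists xs)) F    ≡⟨ ∑-++ (sublists xs) _ F ⟩
    S + ∑ (map (x ∷_) (sublists xs)) F               ≡⟨ cong (_+_ S) (∑-map (x ∷_) (sublists xs) F) ⟩
    S + ∑[ g ∈ sublists xs ] F (x ∷ g)               ≡⟨ cong (_+_ S) (∑-cong-∈ (sublists xs) (F-∷ ∘ x∉)) ⟩
    S + ∑[ g ∈ sublists xs ] (w x * F g)             ≡⟨ cong (_+_ S) (*-distribˡ-∑ (w x) (sublists xs) F) ⟨
    S + w x * S                                      ≡⟨ s+ws≡[1+w]s S (w x) ⟩
    (1ℤ + w x) * S                                   ≡⟨ cong ((1ℤ + w x) *_) IH ⟩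
    (1ℤ + w x) * ∏[ x ∈ xs ] (1ℤ + w x)              ∎
    where
    open ≡-Reasoning
    S = ∑ (sublists xs) F
    IH = ∑-sublists-multiplicative F w F[]≡1 F-∷ xs!
    x∉ : ∀ {g} → g ∈ˡ sublists xs → x ∉ˡ g
    x∉ g∈ x∈g = All.lookup x∉xs (∈-sublists⇒⊆ g∈ x∈g) refl
    s+ws≡[1+w]s : ∀ s w → s + w * s ≡ (1ℤ + w) * s
    s+ws≡[1+w]s = solve-∀

  ∑-sublists-scale-[] : ∀ t (F : List A → ℤ) xs →
    ∑[ g ∈ sublists xs ] (F g * t ^ᵇ does (length g ℕ.≟ 0)) ≡ (t - 1ℤ) * F [] + ∑ (sublists xs) F
  ∑-sublists-scale-[] t F [] = Ft≡[t-1]F+F (F []) t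
    where
    Ft≡[t-1]F+F : ∀ f t → f * t + 0ℤ ≡ (t - 1ℤ) * f + (f + 0ℤ)
    Ft≡[t-1]F+F = solve-∀
  ∑-sublists-scale-[] t F (x ∷ xs) = begin
    ∑ (sublists xs ++ map (x ∷_) (sublists xs)) Fτ
      ≡⟨ ∑-++ (sublists xs) _ Fτ ⟩
    ∑ (sublists xs) Fτ + ∑ (map (x ∷_) (sublists xs)) Fτ
      ≡⟨ cong₂ _+_ (∑-sublists-scale-[] t F xs) (∑-map (x ∷_) (sublists xs) Fτ) ⟩
    ((t - 1ℤ) * F [] + ∑ (sublists xs) F) + ∑[ g ∈ sublists xs ] (F (x ∷ g) * 1ℤ)
      ≡⟨ cong (_+_ ((t - 1ℤ) * F [] + ∑ (sublists xs) F)) (∑-cong (sublists xs) (ℤ.*-identityʳ ∘ F ∘ (x ∷_))) ⟩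
    ((t - 1ℤ) * F [] + ∑ (sublists xs) F) + ∑[ g ∈ sublists xs ] F (x ∷ g)
      ≡⟨ ℤ.+-assoc ((t - 1ℤ) * F []) _ _ ⟩
    (t - 1ℤ) * F [] + (∑ (sublists xs) F + ∑[ g ∈ sublists xs ] F (x ∷ g))
      ≡⟨ cong (λ s → (t - 1ℤ) * F [] + (∑ (sublists xs) F + s)) (∑-map (x ∷_) (sublists xs) F) ⟨
    (t - 1ℤ) * F [] + (∑ (sublists xs) F + ∑ (map (x ∷_) (sublists xs)) F)
      ≡⟨ cong (_+_ ((t - 1ℤ) * F [])) (∑-++ (sublists xs) _ F) ⟨
    (t - 1ℤ) * F [] + ∑ (sublists (x ∷ xs)) F
      ∎
    where
    open ≡-Reasoning
    Fτ : List A → ℤ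
    Fτ g = F g * t ^ᵇ does (length g ℕ.≟ 0)

filter∈sublists : ∀ {a p} {A : Set a} {P : Pred A p} (P? : Decidable P) xs → filter P? xs ∈ˡ sublists xs
filter∈sublists P? []       = here refl
filter∈sublists P? (x ∷ xs) with does (P? x)
... | true  = ∈-++⁺ʳ (sublists xs) (∈-map⁺ (x ∷_) (filter∈sublists P? xs))
... | false = ∈-++⁺ˡ (filter∈sublists P? xs)

2^∣xs∣*∏⟦even⟧ : ∀ {a} {A : Set a} {xs : List A} (m : A → ℕ) → Unique xs →
  (+ 2) ^ length xs * ∏[ x ∈ xs ] ⟦ 2 ∣? m x ⟧ ≡ ∑[ G ∈ sublists xs ] ∏[ x ∈ G ] (-1ℤ ^ m x)
2^∣xs∣*∏⟦even⟧ {xs = xs} m xs! = begin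
  (+ 2) ^ length xs * ∏[ x ∈ xs ] ⟦ 2 ∣? m x ⟧     ≡⟨ ∏-scale (+ 2) xs (λ x → ⟦ 2 ∣? m x ⟧) ⟨
  ∏[ x ∈ xs ] (+ 2 * ⟦ 2 ∣? m x ⟧)                  ≡⟨ ∏-cong xs (2⟦2∣m⟧≡1+-1^m ∘ m) ⟩
  ∏[ x ∈ xs ] (1ℤ + -1ℤ ^ m x)                      ≡⟨ ∑-sublists-multiplicative F (λ x → -1ℤ ^ m x) refl (λ _ → refl) xs! ⟨
  ∑[ G ∈ sublists xs ] ∏[ x ∈ G ] (-1ℤ ^ m x)        ∎
  where
  open ≡-Reasoning
  F : List _ → ℤ
  F G = ∏[ x ∈ G ] (-1ℤ ^ m x)

-- Enumerating the subsets of [n]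

module _ {a b p q} {A : Set a} {B : Set b} {P : Pred B p} {Q : Pred A q}
         (P? : Decidable P) (Q? : Decidable Q) where

  filter-map-does : (f : A → B) → (∀ x → does (P? (f x)) ≡ does (Q? x)) →
                    ∀ xs → filter P? (map f xs) ≡ map f (filter Q? xs)
  filter-map-does f P∘f≡Q [] = refl
  filter-map-does f P∘f≡Q (x ∷ xs) with does (P? (f x)) | does (Q? x) | P∘f≡Q x
  ... | true  | true  | refl = cong (f x ∷_) (filter-map-does f P∘f≡Q xs)
  ... | false | false | refl = filter-map-does f P∘f≡Q xs

allSubsets-unique : ∀ n → Unique (allSubsets n)
allSubsets-unique zero    = [] ∷ []
allSubsets-unique (suc n) =
  Unique.++⁺ (Unique.map⁺ ∷-injectiveʳ (allSubsets-unique n))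
             (Unique.map⁺ ∷-injectiveʳ (allSubsets-unique n)) disjoint
  where
  ∷-injectiveʳ : ∀ {b} {S T : Subset n} → b ∷ S ≡ b ∷ T → S ≡ T
  ∷-injectiveʳ refl = refl
  disjoint : ∀ {S} → ¬ (S ∈ˡ map (outside ∷_) (allSubsets n) × S ∈ˡ map (inside ∷_) (allSubsets n))
  disjoint (∈out , ∈in) with ∈-map⁻ (outside ∷_) ∈out | ∈-map⁻ (inside ∷_) ∈in
  ... | _ , _ , refl | _ , _ , ()

∈-allSubsets : ∀ {n} (S : Subset n) → S ∈ˡ allSubsets n
∈-allSubsets []                = here refl
∈-allSubsets {suc n} (false ∷ S) = ∈-++⁺ˡ (∈-map⁺ (outside ∷_) (∈-allSubsets S))
∈-allSubsets {suc n} (true ∷ S)  =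
  ∈-++⁺ʳ (map (outside ∷_) (allSubsets n)) (∈-map⁺ (inside ∷_) (∈-allSubsets S))

choose-unique : ∀ n j → Unique (choose n j)
choose-unique n j = Unique.filter⁺ (λ S → ∣ S ∣ ℕ.≟ j) (allSubsets-unique n)

∈-choose⁺ : ∀ {n j} {S : Subset n} → ∣ S ∣ ≡ j → S ∈ˡ choose n j
∈-choose⁺ {n} {j} {S} ∣S∣≡j = ∈-filter⁺ (λ S → ∣ S ∣ ℕ.≟ j) (∈-allSubsets S) ∣S∣≡j

∈-choose⁻ : ∀ {n j} {S : Subset n} → S ∈ˡ choose n j → ∣ S ∣ ≡ j
∈-choose⁻ {n} {j} S∈ = proj₂ (∈-filter⁻ (λ S → ∣ S ∣ ℕ.≟ j) {xs = allSubsets n} S∈)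

pairsIn-unique : ∀ {n} (S : Subset n) → Unique (pairsIn S)
pairsIn-unique {n} S = Unique.filter⁺ (_⊆? S) (choose-unique n 2)

∈-pairsIn⁺ : ∀ {n} {S e : Subset n} → ∣ e ∣ ≡ 2 → e ⊆ S → e ∈ˡ pairsIn S
∈-pairsIn⁺ {S = S} ∣e∣≡2 e⊆S = ∈-filter⁺ (_⊆? S) (∈-choose⁺ ∣e∣≡2) e⊆S

∈-pairsIn⁻ : ∀ {n} {S e : Subset n} → e ∈ˡ pairsIn S → ∣ e ∣ ≡ 2 × e ⊆ S
∈-pairsIn⁻ {n} {S} e∈ with e∈choose , e⊆S ← ∈-filter⁻ (_⊆? S) {xs = choose n 2} e∈ =
  ∈-choose⁻ e∈choose , e⊆S

module _ {n : ℕ} where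

  insideHeadOfSize : ℕ → List (Subset (suc n))
  insideHeadOfSize j = filter (λ T → ∣ T ∣ ℕ.≟ j) (map (inside ∷_) (allSubsets n))

  choose-suc : ∀ j → choose (suc n) j ≡ map (outside ∷_) (choose n j) ++ insideHeadOfSize j
  choose-suc j = trans (List.filter-++ (λ T → ∣ T ∣ ℕ.≟ j) (map (outside ∷_) (allSubsets n)) _)
                       (cong (_++ insideHeadOfSize j) (filter-map-does _ _ (outside ∷_) (λ _ → refl) (allSubsets n)))

  insideHeadOfSize-zero : insideHeadOfSize 0 ≡ []
  insideHeadOfSize-zero =
    List.filter-none (λ T → ∣ T ∣ ℕ.≟ 0) (All.map⁺ {xs = allSubsets n} (All.tabulate (λ _ ())))

  insideHeadOfSize-suc : ∀ j → insideHeadOfSize (suc j) ≡ map (inside ∷_) (choose n j)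
  insideHeadOfSize-suc j = filter-map-does _ _ (inside ∷_) (λ _ → refl) (allSubsets n)

  module _ (S : Subset n) (Ts : List (Subset n)) where

    length-filter-⊆-outside : ∀ b →
      length (filter (_⊆? (b ∷ S)) (map (outside ∷_) Ts)) ≡ length (filter (_⊆? S) Ts)
    length-filter-⊆-outside b = trans (cong length (filter-map-does _ _ (outside ∷_) (λ _ → refl) Ts))
                                      (List.length-map (outside ∷_) (filter (_⊆? S) Ts))

    length-filter-⊆-inside :
      length (filter (_⊆? (inside ∷ S)) (map (inside ∷_) Ts)) ≡ length (filter (_⊆? S) Ts)
    length-filter-⊆-inside = trans (cong length (filter-map-does _ _ (inside ∷_) (λ _ → refl) Ts))
                                   (List.length-map (inside ∷_) (filter (_⊆? S) Ts))

    length-filter-⊆-inside-outside : length (filter (_⊆? (outside ∷ S)) (map (inside ∷_) Ts)) ≡ 0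
    length-filter-⊆-inside-outside =
      cong length (List.filter-none (_⊆? (outside ∷ S)) (All.map⁺ {xs = Ts} (All.tabulate λ _ → inside⊈outside)))
      where
      inside⊈outside : ∀ {T} → ¬ (inside ∷ T ⊆ outside ∷ S)
      inside⊈outside sub with sub Vec.here
      ... | ()

length-filter-⊆-choose : ∀ n j (S : Subset n) → length (filter (_⊆? S) (choose n j)) ≡ ∣ S ∣ C j
length-filter-⊆-choose zero    zero    [] = refl
length-filter-⊆-choose zero    (suc j) [] = refl
length-filter-⊆-choose (suc n) j (b ∷ S) = begin
  length (filter (_⊆? (b ∷ S)) (choose (suc n) j))
    ≡⟨ cong (length ∘ filter (_⊆? (b ∷ S))) (choose-suc j) ⟩
  length (filter (_⊆? (b ∷ S)) (map (outside ∷_) (choose n j) ++ insideHeadOfSize j))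
    ≡⟨ cong length (List.filter-++ (_⊆? (b ∷ S)) (map (outside ∷_) (choose n j)) _) ⟩
  length (filter (_⊆? (b ∷ S)) (map (outside ∷_) (choose n j)) ++ filter (_⊆? (b ∷ S)) (insideHeadOfSize j))
    ≡⟨ List.length-++ (filter (_⊆? (b ∷ S)) (map (outside ∷_) (choose n j))) ⟩
  length (filter (_⊆? (b ∷ S)) (map (outside ∷_) (choose n j))) ℕ.+ #inside b j
    ≡⟨ cong (ℕ._+ #inside b j) (trans (length-filter-⊆-outside S (choose n j) b) (length-filter-⊆-choose n j S)) ⟩
  ∣ S ∣ C j ℕ.+ #inside b j
    ≡⟨ pascal b j ⟩
  ∣ b ∷ S ∣ C j
    ∎
  where
  open ≡-Reasoning
  #inside : Bool → ℕ → ℕ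
  #inside b j = length (filter (_⊆? (b ∷ S)) (insideHeadOfSize j))
  #inside-zero : ∀ b → #inside b 0 ≡ 0
  #inside-zero b = cong (length ∘ filter (_⊆? (b ∷ S))) (insideHeadOfSize-zero {n})
  #inside-suc : ∀ b j → #inside b (suc j) ≡ length (filter (_⊆? (b ∷ S)) (map (inside ∷_) (choose n j)))
  #inside-suc b j = cong (length ∘ filter (_⊆? (b ∷ S))) (insideHeadOfSize-suc j)
  pascal : ∀ b j → ∣ S ∣ C j ℕ.+ #inside b j ≡ ∣ b ∷ S ∣ C j
  pascal false zero    = trans (cong (∣ S ∣ C 0 ℕ.+_) (#inside-zero false)) (ℕ.+-identityʳ _)
  pascal true  zero    = trans (cong (∣ S ∣ C 0 ℕ.+_) (#inside-zero true)) (ℕ.+-identityʳ _)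
  pascal false (suc j) = trans (cong (∣ S ∣ C suc j ℕ.+_) #inside≡0) (ℕ.+-identityʳ _)
    where
    #inside≡0 = trans (#inside-suc false j) (length-filter-⊆-inside-outside S (choose n j))
  pascal true  (suc j) = begin
    ∣ S ∣ C suc j ℕ.+ #inside true (suc j)  ≡⟨ cong (∣ S ∣ C suc j ℕ.+_) #inside≡∣S∣Cj ⟩
    ∣ S ∣ C suc j ℕ.+ ∣ S ∣ C j             ≡⟨ ℕ.+-comm (∣ S ∣ C suc j) (∣ S ∣ C j) ⟩
    ∣ S ∣ C j ℕ.+ ∣ S ∣ C suc j             ≡⟨ nCk+nC[k+1]≡[n+1]C[k+1] ∣ S ∣ j ⟩
    suc ∣ S ∣ C suc j                       ∎
    where
    #inside≡∣S∣Cj = trans (#inside-suc true j)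
                          (trans (length-filter-⊆-inside S (choose n j)) (length-filter-⊆-choose n j S))

[2+n]C2≡1+n+[1+n]C2 : ∀ n → suc (suc n) C 2 ≡ suc (n ℕ.+ suc n C 2)
[2+n]C2≡1+n+[1+n]C2 n = begin
  suc (suc n) C 2          ≡⟨ nCk+nC[k+1]≡[n+1]C[k+1] (suc n) 1 ⟨
  suc n C 1 ℕ.+ suc n C 2  ≡⟨ cong (ℕ._+ suc n C 2) (nC1≡n (suc n)) ⟩
  suc (n ℕ.+ suc n C 2)    ∎
  where open ≡-Reasoning

suc[nC2∸1]≡nC2 : ∀ {n} → 2 ≤ n → suc (n C 2 ∸ 1) ≡ n C 2
suc[nC2∸1]≡nC2 {suc (suc n)} (s≤s (s≤s _)) rewrite [2+n]C2≡1+n+[1+n]C2 n = refl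

length-pairsIn : ∀ {n k} {S : Subset n} → 2 ≤ k → S ∈ˡ choose n k →
                 length (pairsIn S) ≡ suc (k C 2 ∸ 1)
length-pairsIn {n} {k} {S} 2≤k S∈ = begin
  length (pairsIn S)  ≡⟨ length-filter-⊆-choose n 2 S ⟩
  ∣ S ∣ C 2           ≡⟨ cong (_C 2) (∈-choose⁻ S∈) ⟩
  k C 2               ≡⟨ suc[nC2∸1]≡nC2 2≤k ⟨
  suc (k C 2 ∸ 1)     ∎
  where open ≡-Reasoning

-- Expanding the parity conditions of 𝓑

infix 4 _∈ᵇ_
_∈ᵇ_ : ∀ {n} → Subset n → List (Subset n) → Bool
e ∈ᵇ g = does (∈?-dec _≟ˢ_ e g)

χ : ∀ {n} (G g : List (Subset n)) → ℤ
χ G g = ∏[ e ∈ G ] (-1ℤ ^ᵇ (e ∈ᵇ g))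

-- The term of the block sum of a k-set S at the edge set G, for the graph g on S.
weight : ∀ {n} → ℤ → (G g : List (Subset n)) → ℤ
weight t G g = ⟦ 2 ∣? length g ⟧ * t ^ᵇ does (length g ℕ.≟ 0) * χ G g

∑-assignmentsOver : ∀ {n} (Ss : List (Subset n)) (ψ : Subset n × List (Subset n) → ℤ) →
  ∑[ h ∈ assignmentsOver Ss ] ∏ h ψ ≡ ∏[ S ∈ Ss ] ∑[ g ∈ graphsOn S ] ψ (S , g)
∑-assignmentsOver []       ψ = refl
∑-assignmentsOver (S ∷ Ss) ψ = begin
  ∑ (concatMap (λ g → map ((S , g) ∷_) (assignmentsOver Ss)) (graphsOn S)) (λ h → ∏ h ψ)
    ≡⟨ ∑-concatMap (λ g → map ((S , g) ∷_) (assignmentsOver Ss)) (graphsOn S) (λ h → ∏ h ψ) ⟩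
  ∑[ g ∈ graphsOn S ] ∑ (map ((S , g) ∷_) (assignmentsOver Ss)) (λ h → ∏ h ψ)
    ≡⟨ ∑-cong (graphsOn S) (λ g → ∑-map ((S , g) ∷_) (assignmentsOver Ss) (λ h → ∏ h ψ)) ⟩
  ∑[ g ∈ graphsOn S ] ∑[ h ∈ assignmentsOver Ss ] (ψ (S , g) * ∏ h ψ)
    ≡⟨ ∑-cong (graphsOn S) (λ g → *-distribˡ-∑ (ψ (S , g)) (assignmentsOver Ss) (λ h → ∏ h ψ)) ⟨
  ∑[ g ∈ graphsOn S ] (ψ (S , g) * Rest)
    ≡⟨ *-distribʳ-∑ Rest (graphsOn S) (λ g → ψ (S , g)) ⟨
  ∑[ g ∈ graphsOn S ] ψ (S , g) * Rest
    ≡⟨ cong (_*_ (∑[ g ∈ graphsOn S ] ψ (S , g))) (∑-assignmentsOver Ss ψ) ⟩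
  ∑[ g ∈ graphsOn S ] ψ (S , g) * ∏[ S ∈ Ss ] ∑[ g ∈ graphsOn S ] ψ (S , g)
    ∎
  where
  open ≡-Reasoning
  Rest = ∑[ h ∈ assignmentsOver Ss ] ∏ h ψ

module _ {n : ℕ} where

  private
    E : List (Subset n)
    E = choose n 2

    2^E : ℤ
    2^E = (+ 2) ^ length E

  ⟦InB?⟧ : (h : Assignment n) →
    ⟦ InB? h ⟧ ≡ ∏[ p ∈ h ] ⟦ 2 ∣? length (proj₂ p) ⟧ * ∏[ e ∈ E ] ⟦ 2 ∣? countContaining e h ⟧
  ⟦InB?⟧ h = trans (⟦×-dec⟧ (all? _ h) (all? _ E)) (cong₂ _*_ (⟦all?⟧ _ h) (⟦all?⟧ _ E))

  2^E*⟦even-degrees⟧ : (h : Assignment n) →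
    2^E * ∏[ e ∈ E ] ⟦ 2 ∣? countContaining e h ⟧ ≡ ∑[ G ∈ sublists E ] ∏[ p ∈ h ] χ G (proj₂ p)
  2^E*⟦even-degrees⟧ h = trans (2^∣xs∣*∏⟦even⟧ (λ e → countContaining e h) (choose-unique n 2))
                               (∑-cong (sublists E) (λ G → trans (∏-cong G -1^degree) (∏-comm G h _)))
    where
    -1^degree : ∀ e → -1ℤ ^ countContaining e h ≡ ∏[ p ∈ h ] (-1ℤ ^ᵇ (e ∈ᵇ proj₂ p))
    -1^degree e = ^-length-filter (λ p → ∈?-dec _≟ˢ_ e (proj₂ p)) -1ℤ h

  2^E*summand : ∀ t (h : Assignment n) →
    2^E * (⟦ InB? h ⟧ * t ^ emptyCount h) ≡ ∑[ G ∈ sublists E ] ∏[ p ∈ h ] weight t G (proj₂ p)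
  2^E*summand t h = begin
    2^E * (⟦ InB? h ⟧ * t ^ emptyCount h)
      ≡⟨ cong₂ (λ a b → 2^E * (a * b)) (⟦InB?⟧ h) (^-length-filter (λ p → length (proj₂ p) ℕ.≟ 0) t h) ⟩
    2^E * (EvenSizes * Degrees * Empty)
      ≡⟨ rearrange 2^E EvenSizes Degrees Empty ⟩
    EvenSizes * Empty * (2^E * Degrees)
      ≡⟨ cong (_*_ (EvenSizes * Empty)) (2^E*⟦even-degrees⟧ h) ⟩
    EvenSizes * Empty * ∑[ G ∈ sublists E ] ∏[ p ∈ h ] χ G (proj₂ p)
      ≡⟨ *-distribˡ-∑ (EvenSizes * Empty) (sublists E) _ ⟩
    ∑[ G ∈ sublists E ] (EvenSizes * Empty * ∏[ p ∈ h ] χ G (proj₂ p))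
      ≡⟨ ∑-cong (sublists E) ∏-weight ⟨
    ∑[ G ∈ sublists E ] ∏[ p ∈ h ] weight t G (proj₂ p)
      ∎
    where
    open ≡-Reasoning
    EvenSizes Degrees Empty : ℤ
    EvenSizes = ∏[ p ∈ h ] ⟦ 2 ∣? length (proj₂ p) ⟧
    Degrees   = ∏[ e ∈ E ] ⟦ 2 ∣? countContaining e h ⟧
    Empty     = ∏[ p ∈ h ] (t ^ᵇ does (length (proj₂ p) ℕ.≟ 0))
    rearrange : ∀ a b c d → a * (b * c * d) ≡ b * d * (a * c)
    rearrange = solve-∀
    ∏-weight : ∀ G → ∏[ p ∈ h ] weight t G (proj₂ p) ≡ EvenSizes * Empty * ∏[ p ∈ h ] χ G (proj₂ p)
    ∏-weight G = trans (∏-distrib-* h _ _) (cong (_* _) (∏-distrib-* h _ _))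

  expansion : ∀ k t →
    2^E * Q n k t ≡ ∑[ G ∈ sublists E ] ∏[ S ∈ choose n k ] ∑[ g ∈ graphsOn S ] weight t G g
  expansion k t = begin
    2^E * ∑[ h ∈ 𝓑 n k ] (t ^ emptyCount h)
      ≡⟨ cong (_*_ 2^E) (∑-filter InB? (assignments n k) (λ h → t ^ emptyCount h)) ⟩
    2^E * ∑[ h ∈ assignments n k ] (⟦ InB? h ⟧ * t ^ emptyCount h)
      ≡⟨ *-distribˡ-∑ 2^E (assignments n k) _ ⟩
    ∑[ h ∈ assignments n k ] (2^E * (⟦ InB? h ⟧ * t ^ emptyCount h))
      ≡⟨ ∑-cong (assignments n k) (2^E*summand t) ⟩
    ∑[ h ∈ assignments n k ] ∑[ G ∈ sublists E ] ∏[ p ∈ h ] weight t G (proj₂ p)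
      ≡⟨ ∑-comm (assignments n k) (sublists E) _ ⟩
    ∑[ G ∈ sublists E ] ∑[ h ∈ assignments n k ] ∏[ p ∈ h ] weight t G (proj₂ p)
      ≡⟨ ∑-cong (sublists E) (λ G → ∑-assignmentsOver (choose n k) (λ p → weight t G (proj₂ p))) ⟩
    ∑[ G ∈ sublists E ] ∏[ S ∈ choose n k ] ∑[ g ∈ graphsOn S ] weight t G g
      ∎
    where open ≡-Reasoning

-- Block sums

-- G is read as a 2-colouring of the pairs; counting occurrences mod 2 rather than testing membership
-- makes χ-∷ hold for every list G, not only duplicate-free ones.
parityIn : ∀ {n} → List (Subset n) → Subset n → Bool
parityIn G x = foldr (λ e b → does (e ≟ˢ x) xor b) false G

Coloured : ∀ {n} → List (Subset n) → Bool → List (Subset n) → Set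
Coloured G a P = All (λ x → parityIn G x ≡ a) P

coloured? : ∀ {n} (G : List (Subset n)) a P → Dec (Coloured G a P)
coloured? G a = all? (λ x → parityIn G x Bool.≟ a)

Monochromatic : ∀ {n} → List (Subset n) → List (Subset n) → Set
Monochromatic G P = ∃[ a ] Coloured G a P

monochromatic? : ∀ {n} (G P : List (Subset n)) → Dec (Monochromatic G P)
monochromatic? G P = map′ fromSum toSum (coloured? G false P ⊎-dec coloured? G true P)
  where
  fromSum : Coloured G false P ⊎ Coloured G true P → Monochromatic G P
  fromSum (inj₁ all-false) = false , all-false
  fromSum (inj₂ all-true)  = true , all-true
  toSum : Monochromatic G P → Coloured G false P ⊎ Coloured G true P
  toSum (false , all-false) = inj₁ all-false
  toSum (true  , all-true)  = inj₂ all-true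

module _ {n : ℕ} where

  ∏-1^ᵇ≟ : ∀ (G : List (Subset n)) x → ∏[ e ∈ G ] (-1ℤ ^ᵇ does (e ≟ˢ x)) ≡ -1ℤ ^ᵇ parityIn G x
  ∏-1^ᵇ≟ []      x = refl
  ∏-1^ᵇ≟ (e ∷ G) x = trans (cong (_*_ (-1ℤ ^ᵇ does (e ≟ˢ x))) (∏-1^ᵇ≟ G x))
                           (sym (-1^ᵇ-xor (does (e ≟ˢ x)) (parityIn G x)))

  ∈ᵇ-∷ : ∀ {x : Subset n} {g} → x ∉ˡ g → ∀ e → (e ∈ᵇ x ∷ g) ≡ does (e ≟ˢ x) xor (e ∈ᵇ g)
  ∈ᵇ-∷ {x} {g} x∉g e with e ≟ˢ x
  ... | yes refl = sym (cong Bool.not (dec-false (∈?-dec _≟ˢ_ e g) x∉g))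
  ... | no  _    = refl

  χ-∷ : ∀ G {x : Subset n} {g} → x ∉ˡ g → χ G (x ∷ g) ≡ -1ℤ ^ᵇ parityIn G x * χ G g
  χ-∷ G {x} {g} x∉g = begin
    ∏[ e ∈ G ] (-1ℤ ^ᵇ (e ∈ᵇ x ∷ g))
      ≡⟨ ∏-cong G (λ e → trans (cong (-1ℤ ^ᵇ_) (∈ᵇ-∷ x∉g e)) (-1^ᵇ-xor (does (e ≟ˢ x)) (e ∈ᵇ g))) ⟩
    ∏[ e ∈ G ] (-1ℤ ^ᵇ does (e ≟ˢ x) * -1ℤ ^ᵇ (e ∈ᵇ g))
      ≡⟨ ∏-distrib-* G _ _ ⟩
    ∏[ e ∈ G ] (-1ℤ ^ᵇ does (e ≟ˢ x)) * χ G g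
      ≡⟨ cong (_* χ G g) (∏-1^ᵇ≟ G x) ⟩
    -1ℤ ^ᵇ parityIn G x * χ G g
      ∎
    where open ≡-Reasoning

  ∑-sublists-signedχ : ∀ a G {P : List (Subset n)} → Unique P →
    ∑[ g ∈ sublists P ] ((-1ℤ ^ᵇ a) ^ length g * χ G g) ≡ (+ 2) ^ length P * ⟦ coloured? G a P ⟧
  ∑-sublists-signedχ a G {P} P! = begin
    ∑[ g ∈ sublists P ] (s ^ length g * χ G g)
      ≡⟨ ∑-sublists-multiplicative (λ g → s ^ length g * χ G g) w (trans (ℤ.*-identityˡ _) (∏-one G)) F-∷ P! ⟩
    ∏[ x ∈ P ] (1ℤ + w x)
      ≡⟨ ∏-cong P (λ x → 1+-1^ᵇ*-1^ᵇ a (parityIn G x)) ⟩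
    ∏[ x ∈ P ] ((+ 2) * ⟦ parityIn G x Bool.≟ a ⟧)
      ≡⟨ ∏-scale (+ 2) P (λ x → ⟦ parityIn G x Bool.≟ a ⟧) ⟩
    (+ 2) ^ length P * ∏[ x ∈ P ] ⟦ parityIn G x Bool.≟ a ⟧
      ≡⟨ cong ((+ 2) ^ length P *_) (⟦all?⟧ (λ x → parityIn G x Bool.≟ a) P) ⟨
    (+ 2) ^ length P * ⟦ coloured? G a P ⟧
      ∎
    where
    open ≡-Reasoning
    s = -1ℤ ^ᵇ a
    w : Subset n → ℤ
    w x = s * -1ℤ ^ᵇ parityIn G x
    F-∷ : ∀ {x g} → x ∉ˡ g → s ^ suc (length g) * χ G (x ∷ g) ≡ w x * (s ^ length g * χ G g)
    F-∷ {x} {g} x∉g = trans (cong (s ^ suc (length g) *_) (χ-∷ G x∉g))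
                            (reassoc s (s ^ length g) (-1ℤ ^ᵇ parityIn G x) (χ G g))
      where
      reassoc : ∀ a b c d → a * b * (c * d) ≡ a * c * (b * d)
      reassoc = solve-∀

  2*∑-sublists-weight : ∀ t G {P : List (Subset n)} → Unique P →
    (+ 2) * ∑[ g ∈ sublists P ] weight t G g
      ≡ (+ 2) * (t - 1ℤ) + (+ 2) ^ length P * (⟦ coloured? G false P ⟧ + ⟦ coloured? G true P ⟧)
  2*∑-sublists-weight t G {P} P! = begin
    (+ 2) * ∑[ g ∈ sublists P ] weight t G g
      ≡⟨ *-distribˡ-∑ (+ 2) (sublists P) (weight t G) ⟩
    ∑[ g ∈ sublists P ] ((+ 2) * weight t G g)
      ≡⟨ ∑-cong (sublists P) 2*weight ⟩
    ∑[ g ∈ sublists P ] (F false g * τ g + F true g * τ g)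
      ≡⟨ ∑-distrib-+ (sublists P) _ _ ⟩
    ∑[ g ∈ sublists P ] (F false g * τ g) + ∑[ g ∈ sublists P ] (F true g * τ g)
      ≡⟨ cong₂ _+_ (∑-sublists-scale-[] t (F false) P) (∑-sublists-scale-[] t (F true) P) ⟩
    ((t - 1ℤ) * F false [] + ∑ (sublists P) (F false)) + ((t - 1ℤ) * F true [] + ∑ (sublists P) (F true))
      ≡⟨ cong₂ _+_ (cong₂ _+_ (cong ((t - 1ℤ) *_) (F[] false)) (∑-sublists-signedχ false G P!))
                   (cong₂ _+_ (cong ((t - 1ℤ) *_) (F[] true))  (∑-sublists-signedχ true G P!)) ⟩
    ((t - 1ℤ) * 1ℤ + 2^P * ⟦ coloured? G false P ⟧) + ((t - 1ℤ) * 1ℤ + 2^P * ⟦ coloured? G true P ⟧)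
      ≡⟨ collect (t - 1ℤ) 2^P ⟦ coloured? G false P ⟧ ⟦ coloured? G true P ⟧ ⟩
    (+ 2) * (t - 1ℤ) + 2^P * (⟦ coloured? G false P ⟧ + ⟦ coloured? G true P ⟧)
      ∎
    where
    open ≡-Reasoning
    2^P = (+ 2) ^ length P
    F : Bool → List (Subset n) → ℤ
    F a g = (-1ℤ ^ᵇ a) ^ length g * χ G g
    τ : List (Subset n) → ℤ
    τ g = t ^ᵇ does (length g ℕ.≟ 0)
    F[] : ∀ a → F a [] ≡ 1ℤ
    F[] a = trans (ℤ.*-identityˡ _) (∏-one G)
    collect : ∀ u p e o → (u * 1ℤ + p * e) + (u * 1ℤ + p * o) ≡ (+ 2) * u + p * (e + o)
    collect = solve-∀
    2*weight : ∀ g → (+ 2) * weight t G g ≡ F false g * τ g + F true g * τ g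
    2*weight g = begin
      (+ 2) * (⟦ 2 ∣? length g ⟧ * τ g * χ G g)
        ≡⟨ reassoc (+ 2) ⟦ 2 ∣? length g ⟧ (τ g) (χ G g) ⟩
      (+ 2) * ⟦ 2 ∣? length g ⟧ * τ g * χ G g
        ≡⟨ cong (λ c → c * τ g * χ G g) (2⟦2∣m⟧≡1+-1^m (length g)) ⟩
      (1ℤ + -1ℤ ^ length g) * τ g * χ G g
        ≡⟨ cong (λ c → (c + -1ℤ ^ length g) * τ g * χ G g) (ℤ.^-zeroˡ (length g)) ⟨
      (1ℤ ^ length g + -1ℤ ^ length g) * τ g * χ G g
        ≡⟨ expand (1ℤ ^ length g) (-1ℤ ^ length g) (τ g) (χ G g) ⟩
      F false g * τ g + F true g * τ g
        ∎
      where
      reassoc : ∀ a b c d → a * (b * c * d) ≡ a * b * c * d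
      reassoc = solve-∀
      expand : ∀ a b c d → (a + b) * c * d ≡ a * d * c + b * d * c
      expand = solve-∀

2*∑-sublists-weight-at-t₀ : ∀ {n} m G {P : List (Subset n)} → Unique P → length P ≡ suc m →
  (+ 2) * ∑[ g ∈ sublists P ] weight (1ℤ - (+ 2) ^ m) G g ≡ - ((+ 2) ^ suc m) * ⟦ ¬? (monochromatic? G P) ⟧
2*∑-sublists-weight-at-t₀ m G {x ∷ xs} P! ∣P∣≡1+m = begin
  (+ 2) * ∑[ g ∈ sublists (x ∷ xs) ] weight t₀ G g
    ≡⟨ 2*∑-sublists-weight t₀ G P! ⟩
  (+ 2) * (t₀ - 1ℤ) + (+ 2) ^ length (x ∷ xs) * #colours
    ≡⟨ cong (λ l → (+ 2) * (t₀ - 1ℤ) + (+ 2) ^ l * #colours) ∣P∣≡1+m ⟩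
  (+ 2) * (t₀ - 1ℤ) + (+ 2) * (+ 2) ^ m * #colours
    ≡⟨ factor ((+ 2) ^ m) #colours ⟩
  - ((+ 2) ^ suc m) * (1ℤ - #colours)
    ≡⟨ cong (- ((+ 2) ^ suc m) *_) (⟦¬⊎⟧ all-false? all-true? not-both) ⟩
  - ((+ 2) ^ suc m) * ⟦ ¬? (monochromatic? G (x ∷ xs)) ⟧
    ∎
  where
  open ≡-Reasoning
  t₀ = 1ℤ - (+ 2) ^ m
  all-false? = coloured? G false (x ∷ xs)
  all-true?  = coloured? G true (x ∷ xs)
  #colours = ⟦ all-false? ⟧ + ⟦ all-true? ⟧
  not-both : ¬ (Coloured G false (x ∷ xs) × Coloured G true (x ∷ xs))
  not-both ((x-false ∷ _) , (x-true ∷ _)) with () ← trans (sym x-false) x-true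
  factor : ∀ p e → (+ 2) * ((1ℤ - p) - 1ℤ) + (+ 2) * p * e ≡ - ((+ 2) * p) * (1ℤ - e)
  factor = solve-∀

MonochromaticFree : ∀ {n} → ℕ → List (Subset n) → Set
MonochromaticFree {n} k G = All (λ S → ¬ Monochromatic G (pairsIn S)) (choose n k)

monochromaticFree? : ∀ {n} k (G : List (Subset n)) → Dec (MonochromaticFree k G)
monochromaticFree? {n} k G = all? (λ S → ¬? (monochromatic? G (pairsIn S))) (choose n k)

Q-at-1-2^m : ∀ n k m → (∀ {S} → S ∈ˡ choose n k → length (pairsIn S) ≡ suc m) →
  (+ 2) ^ length (choose n k) * ((+ 2) ^ length (choose n 2) * Q n k (1ℤ - (+ 2) ^ m))
    ≡ (- ((+ 2) ^ suc m)) ^ length (choose n k) * ∑[ G ∈ sublists (choose n 2) ] ⟦ monochromaticFree? k G ⟧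
Q-at-1-2^m n k m ∣pairsIn∣≡1+m = begin
  2^K * ((+ 2) ^ length E * Q n k t₀)
    ≡⟨ cong (2^K *_) (expansion {n} k t₀) ⟩
  2^K * ∑[ G ∈ sublists E ] ∏[ S ∈ K ] ∑[ g ∈ graphsOn S ] weight t₀ G g
    ≡⟨ *-distribˡ-∑ 2^K (sublists E) _ ⟩
  ∑[ G ∈ sublists E ] (2^K * ∏[ S ∈ K ] ∑[ g ∈ graphsOn S ] weight t₀ G g)
    ≡⟨ ∑-cong (sublists E) (λ G → ∏-scale (+ 2) K _) ⟨
  ∑[ G ∈ sublists E ] ∏[ S ∈ K ] ((+ 2) * ∑[ g ∈ graphsOn S ] weight t₀ G g)
    ≡⟨ ∑-cong (sublists E) (λ G → ∏-cong-∈ K (block G)) ⟩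
  ∑[ G ∈ sublists E ] ∏[ S ∈ K ] (c * ⟦ ¬? (monochromatic? G (pairsIn S)) ⟧)
    ≡⟨ ∑-cong (sublists E) (λ G → ∏-scale c K _) ⟩
  ∑[ G ∈ sublists E ] (c ^ length K * ∏[ S ∈ K ] ⟦ ¬? (monochromatic? G (pairsIn S)) ⟧)
    ≡⟨ ∑-cong (sublists E) (λ G → cong (c ^ length K *_) (⟦all?⟧ _ K)) ⟨
  ∑[ G ∈ sublists E ] (c ^ length K * ⟦ monochromaticFree? k G ⟧)
    ≡⟨ *-distribˡ-∑ (c ^ length K) (sublists E) _ ⟨
  c ^ length K * ∑[ G ∈ sublists E ] ⟦ monochromaticFree? k G ⟧
    ∎
  where
  open ≡-Reasoning
  K = choose n k
  E = choose n 2
  2^K = (+ 2) ^ length K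
  t₀ = 1ℤ - (+ 2) ^ m
  c = - ((+ 2) ^ suc m)
  block : ∀ G {S} → S ∈ˡ K → (+ 2) * ∑[ g ∈ graphsOn S ] weight t₀ G g ≡ c * ⟦ ¬? (monochromatic? G (pairsIn S)) ⟧
  block G S∈K = 2*∑-sublists-weight-at-t₀ m G (pairsIn-unique _) (∣pairsIn∣≡1+m S∈K)

-- Colourings and the Ramsey property

pair : ∀ {n} → Fin n → Fin n → Subset n
pair i j = ⁅ i ⁆ ∪ ⁅ j ⁆

module _ {n : ℕ} where

  ∈-pair⁻ : ∀ {x i j : Fin n} → x ∈ pair i j → x ≡ i ⊎ x ≡ j
  ∈-pair⁻ {i = i} {j} x∈ with Subsetₚ.x∈p∪q⁻ ⁅ i ⁆ ⁅ j ⁆ x∈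
  ... | inj₁ x∈i = inj₁ (Subsetₚ.x∈⁅y⁆⇒x≡y i x∈i)
  ... | inj₂ x∈j = inj₂ (Subsetₚ.x∈⁅y⁆⇒x≡y j x∈j)

  i∈pair : ∀ (i j : Fin n) → i ∈ pair i j
  i∈pair i j = Subsetₚ.x∈p∪q⁺ (inj₁ (Subsetₚ.x∈⁅x⁆ i))

  j∈pair : ∀ (i j : Fin n) → j ∈ pair i j
  j∈pair i j = Subsetₚ.x∈p∪q⁺ (inj₂ (Subsetₚ.x∈⁅x⁆ j))

  pair-sym : ∀ (i j : Fin n) → pair i j ≡ pair j i
  pair-sym i j = Subsetₚ.∪-comm ⁅ i ⁆ ⁅ j ⁆

  pair⊆ : ∀ {i j : Fin n} {S} → i ∈ S → j ∈ S → pair i j ⊆ S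
  pair⊆ i∈S j∈S x∈ with ∈-pair⁻ x∈
  ... | inj₁ refl = i∈S
  ... | inj₂ refl = j∈S

∣pair∣≡2 : ∀ {n} {i j : Fin n} → i ≢ j → ∣ pair i j ∣ ≡ 2
∣pair∣≡2 {i = Fin.zero}  {Fin.zero}  i≢j = contradiction refl i≢j
∣pair∣≡2 {suc n} {i = Fin.zero}  {Fin.suc j} _ =
  cong suc (trans (cong ∣_∣ (Subsetₚ.∪-identityˡ ⁅ j ⁆)) (Subsetₚ.∣⁅x⁆∣≡1 j))
∣pair∣≡2 {suc n} {i = Fin.suc i} {Fin.zero}  _ =
  cong suc (trans (cong ∣_∣ (Subsetₚ.∪-identityʳ ⁅ i ⁆)) (Subsetₚ.∣⁅x⁆∣≡1 i))
∣pair∣≡2 {i = Fin.suc i} {Fin.suc j} i≢j = ∣pair∣≡2 (i≢j ∘ cong Fin.suc)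

⊆∧∣≡∣⇒≡ : ∀ {n} {p q : Subset n} → p ⊆ q → ∣ p ∣ ≡ ∣ q ∣ → p ≡ q
⊆∧∣≡∣⇒≡ {p = []}        {[]}        _   _ = refl
⊆∧∣≡∣⇒≡ {p = false ∷ p} {false ∷ q} p⊆q ∣p∣≡∣q∣ =
  cong (false ∷_) (⊆∧∣≡∣⇒≡ (Subsetₚ.drop-∷-⊆ p⊆q) ∣p∣≡∣q∣)
⊆∧∣≡∣⇒≡ {p = false ∷ p} {true ∷ q}  p⊆q ∣p∣≡∣q∣ =
  contradiction (Subsetₚ.p⊆q⇒∣p∣≤∣q∣ (Subsetₚ.drop-∷-⊆ p⊆q)) (ℕ.<⇒≱ (ℕ.≤-reflexive (sym ∣p∣≡∣q∣)))
⊆∧∣≡∣⇒≡ {p = true ∷ p}  {false ∷ q} p⊆q _ with p⊆q Vec.here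
... | ()
⊆∧∣≡∣⇒≡ {p = true ∷ p}  {true ∷ q}  p⊆q ∣p∣≡∣q∣ =
  cong (true ∷_) (⊆∧∣≡∣⇒≡ (Subsetₚ.drop-∷-⊆ p⊆q) (ℕ.suc-injective ∣p∣≡∣q∣))

nonempty⇒∃∈ : ∀ {n} (S : Subset n) → 1 ≤ ∣ S ∣ → ∃ (_∈ S)
nonempty⇒∃∈ (true ∷ S)  _ = Fin.zero , Vec.here
nonempty⇒∃∈ (false ∷ S) 1≤∣S∣ with i , i∈S ← nonempty⇒∃∈ S 1≤∣S∣ = Fin.suc i , Vec.there i∈S

two-elements : ∀ {n} (S : Subset n) → 2 ≤ ∣ S ∣ → ∃₂ λ i j → i ≢ j × i ∈ S × j ∈ S
two-elements (true ∷ S)  (s≤s 1≤∣S∣) with j , j∈S ← nonempty⇒∃∈ S 1≤∣S∣ =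
  Fin.zero , Fin.suc j , (λ ()) , Vec.here , Vec.there j∈S
two-elements (false ∷ S) 2≤∣S∣ with i , j , i≢j , i∈S , j∈S ← two-elements S 2≤∣S∣ =
  Fin.suc i , Fin.suc j , i≢j ∘ Fin.suc-injective , Vec.there i∈S , Vec.there j∈S

∣e∣≡2⇒pair : ∀ {n} {e : Subset n} → ∣ e ∣ ≡ 2 → ∃₂ λ i j → i ≢ j × i ∈ e × j ∈ e × e ≡ pair i j
∣e∣≡2⇒pair {e = e} ∣e∣≡2 with i , j , i≢j , i∈e , j∈e ← two-elements e (ℕ.≤-reflexive (sym ∣e∣≡2)) =
  i , j , i≢j , i∈e , j∈e , sym (⊆∧∣≡∣⇒≡ (pair⊆ i∈e j∈e) (trans (∣pair∣≡2 i≢j) (sym ∣e∣≡2)))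

module _ {n : ℕ} (G : List (Subset n)) where

  parityAdj : Fin n → Fin n → Bool
  parityAdj i j = if does (i Fin.≟ j) then false else parityIn G (pair i j)

  parityAdj-sym : ∀ i j → parityAdj i j ≡ parityAdj j i
  parityAdj-sym i j with i Fin.≟ j | j Fin.≟ i
  ... | yes _   | yes _   = refl
  ... | yes i≡j | no  j≢i = contradiction (sym i≡j) j≢i
  ... | no  i≢j | yes j≡i = contradiction (sym j≡i) i≢j
  ... | no  _   | no  _   = cong (parityIn G) (pair-sym i j)

  parityAdj-irrefl : ∀ i → parityAdj i i ≡ false
  parityAdj-irrefl i rewrite dec-true (i Fin.≟ i) refl = refl

  parityAdj-≢ : ∀ {i j} → i ≢ j → parityAdj i j ≡ parityIn G (pair i j)
  parityAdj-≢ {i} {j} i≢j rewrite dec-false (i Fin.≟ j) i≢j = refl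

parityGraph : ∀ {n} → List (Subset n) → Graph n
parityGraph G = record { adj = parityAdj G ; sym = parityAdj-sym G ; irrefl = parityAdj-irrefl G }

module _ {n : ℕ} (G : List (Subset n)) {b : Bool} {S : Subset n} where

  homogeneous⇒coloured : Homogeneous (parityGraph G) b S → Coloured G b (pairsIn S)
  homogeneous⇒coloured hom = All.tabulate colour-b
    where
    colour-b : ∀ {e} → e ∈ˡ pairsIn S → parityIn G e ≡ b
    colour-b {e} e∈ with ∈-pairsIn⁻ e∈
    ... | ∣e∣≡2 , e⊆S with ∣e∣≡2⇒pair ∣e∣≡2
    ...   | i , j , i≢j , i∈e , j∈e , e≡ij = begin
      parityIn G e           ≡⟨ cong (parityIn G) e≡ij ⟩
      parityIn G (pair i j)  ≡⟨ parityAdj-≢ G i≢j ⟨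
      parityAdj G i j        ≡⟨ hom i j (e⊆S i∈e) (e⊆S j∈e) i≢j ⟩
      b                      ∎
      where open ≡-Reasoning

  coloured⇒homogeneous : Coloured G b (pairsIn S) → Homogeneous (parityGraph G) b S
  coloured⇒homogeneous mono i j i∈S j∈S i≢j =
    trans (parityAdj-≢ G i≢j) (All.lookup mono (∈-pairsIn⁺ (∣pair∣≡2 i≢j) (pair⊆ i∈S j∈S)))

Homogeneous-resp : ∀ {n} {Γ Δ : Graph n} {b S} → (∀ {i j} → i ≢ j → Graph.adj Γ i j ≡ Graph.adj Δ i j) →
                   Homogeneous Γ b S → Homogeneous Δ b S
Homogeneous-resp Γ≈Δ hom i j i∈S j∈S i≢j = trans (sym (Γ≈Δ i≢j)) (hom i j i∈S j∈S i≢j)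

module _ {n : ℕ} where

  parityIn-∉ : ∀ {x : Subset n} xs → x ∉ˡ xs → parityIn xs x ≡ false
  parityIn-∉ []       _    = refl
  parityIn-∉ {x} (e ∷ xs) x∉ rewrite dec-false (e ≟ˢ x) (λ e≡x → x∉ (here (sym e≡x))) =
    parityIn-∉ xs (x∉ ∘ there)

  ∉-filter : ∀ {p} {P : Pred (Subset n) p} (P? : Decidable P) {x xs} → x ∉ˡ xs → x ∉ˡ filter P? xs
  ∉-filter P? {xs = xs} x∉xs x∈ = x∉xs (proj₁ (∈-filter⁻ P? {xs = xs} x∈))

  parityIn-filter : ∀ {p} {P : Pred (Subset n) p} (P? : Decidable P) {x} {xs} → Unique xs → x ∈ˡ xs →
                    parityIn (filter P? xs) x ≡ does (P? x)
  parityIn-filter P? {xs = e ∷ xs} (e∉xs ∷ xs!) (here refl) with does (P? e)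
  ... | true  rewrite dec-true (e ≟ˢ e) refl = cong Bool.not (parityIn-∉ (filter P? xs) e∉filter)
    where
    e∉filter : e ∉ˡ filter P? xs
    e∉filter = ∉-filter P? (λ e∈xs → All.lookup e∉xs e∈xs refl)
  ... | false = parityIn-∉ (filter P? xs) (∉-filter P? (λ e∈xs → All.lookup e∉xs e∈xs refl))
  parityIn-filter P? {x} {e ∷ xs} (e∉xs ∷ xs!) (there x∈xs) with does (P? e)
  ... | true  rewrite dec-false (e ≟ˢ x) (λ { refl → All.lookup e∉xs x∈xs refl }) =
    parityIn-filter P? xs! x∈xs
  ... | false = parityIn-filter P? xs! x∈xs

module _ {n : ℕ} (Γ : Graph n) where

  open Graph Γ renaming (sym to adj-sym)

  Joins : Subset n → Set
  Joins e = ∃₂ λ i j → i ∈ e × j ∈ e × adj i j ≡ true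

  joins? : Decidable Joins
  joins? e = Fin.any? λ i → Fin.any? λ j →
    (i Subsetₚ.∈? e) ×-dec (j Subsetₚ.∈? e) ×-dec (adj i j Bool.≟ true)

  joins?-pair : ∀ i j → does (joins? (pair i j)) ≡ adj i j
  joins?-pair i j with adj i j in ij-edge
  ... | true  = dec-true (joins? (pair i j)) (i , j , i∈pair i j , j∈pair i j , ij-edge)
  ... | false = dec-false (joins? (pair i j)) no-join
    where
    no-join : ¬ Joins (pair i j)
    no-join (i′ , j′ , i′∈ , j′∈ , edge) with ∈-pair⁻ i′∈ | ∈-pair⁻ j′∈
    ... | inj₁ refl | inj₁ refl with () ← trans (sym edge) (irrefl i)
    ... | inj₁ refl | inj₂ refl with () ← trans (sym edge) ij-edge
    ... | inj₂ refl | inj₁ refl with () ← trans (sym edge) (trans (adj-sym j i) ij-edge)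
    ... | inj₂ refl | inj₂ refl with () ← trans (sym edge) (irrefl j)

  edgeList : List (Subset n)
  edgeList = filter joins? (choose n 2)

  parityGraph-edgeList : ∀ {i j} → i ≢ j → parityAdj edgeList i j ≡ adj i j
  parityGraph-edgeList {i} {j} i≢j = begin
    parityAdj edgeList i j         ≡⟨ parityAdj-≢ edgeList i≢j ⟩
    parityIn edgeList (pair i j)   ≡⟨ parityIn-filter joins? (choose-unique n 2) (∈-choose⁺ (∣pair∣≡2 i≢j)) ⟩
    does (joins? (pair i j))       ≡⟨ joins?-pair i j ⟩
    adj i j                        ∎
    where open ≡-Reasoning

module _ {n k : ℕ} where

  ramsey⇒noMonochromaticFreeColouring :
    RamseyProperty k n → All (¬_ ∘ MonochromaticFree k) (sublists (choose n 2))
  ramsey⇒noMonochromaticFreeColouring ramsey = All.tabulate (λ {G} _ → hasMonochromatic G)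
    where
    hasMonochromatic : ∀ G → ¬ MonochromaticFree k G
    hasMonochromatic G free with b , S , ∣S∣≡k , hom ← ramsey (parityGraph G) =
      All.lookup free (∈-choose⁺ ∣S∣≡k) (b , homogeneous⇒coloured G hom)

  noMonochromaticFreeColouring⇒ramsey :
    All (¬_ ∘ MonochromaticFree k) (sublists (choose n 2)) → RamseyProperty k n
  noMonochromaticFreeColouring⇒ramsey notFree Γ = homogeneousSet (find someMonochromatic)
    where
    G = edgeList Γ
    someMonochromatic : Any (λ S → Monochromatic G (pairsIn S)) (choose n k)
    someMonochromatic = Any.map (λ {S} → decidable-stable (monochromatic? G (pairsIn S)))
      (All.¬All⇒Any¬ (λ S → ¬? (monochromatic? G (pairsIn S))) (choose n k)
                 (All.lookup notFree (filter∈sublists (joins? Γ) (choose n 2))))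
    homogeneousSet : ∃ (λ S → S ∈ˡ choose n k × Monochromatic G (pairsIn S)) →
                     ∃ λ b → ∃ λ S → ∣ S ∣ ≡ k × Homogeneous Γ b S
    homogeneousSet (S , S∈ , b , mono) =
      b , S , ∈-choose⁻ S∈ ,
      Homogeneous-resp {Γ = parityGraph G} {Δ = Γ} {b = b} {S = S}
                       (parityGraph-edgeList Γ) (coloured⇒homogeneous G mono)

  ramsey⇔noMonochromaticFreeColouring :
    RamseyProperty k n ⇔ All (¬_ ∘ MonochromaticFree k) (sublists (choose n 2))
  ramsey⇔noMonochromaticFreeColouring =
    mk⇔ ramsey⇒noMonochromaticFreeColouring noMonochromaticFreeColouring⇒ramsey

inject≤-subset : ∀ {m n} → Subset m → m ≤ n → Subset n
inject≤-subset []      z≤n       = ⊥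
inject≤-subset (b ∷ S) (s≤s m≤n) = b ∷ inject≤-subset S m≤n

∣inject≤-subset∣ : ∀ {m n} (S : Subset m) (m≤n : m ≤ n) → ∣ inject≤-subset S m≤n ∣ ≡ ∣ S ∣
∣inject≤-subset∣ {n = n} []  z≤n       = Subsetₚ.∣⊥∣≡0 n
∣inject≤-subset∣ (true ∷ S)  (s≤s m≤n) = cong suc (∣inject≤-subset∣ S m≤n)
∣inject≤-subset∣ (false ∷ S) (s≤s m≤n) = ∣inject≤-subset∣ S m≤n

∈-inject≤-subset⁻ : ∀ {m n} (S : Subset m) (m≤n : m ≤ n) {x} → x ∈ inject≤-subset S m≤n →
                    ∃ λ x′ → x ≡ Fin.inject≤ x′ m≤n × x′ ∈ S
∈-inject≤-subset⁻ []      z≤n       x∈ = contradiction x∈ Subsetₚ.∉⊥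
∈-inject≤-subset⁻ (b ∷ S) (s≤s m≤n) Vec.here = Fin.zero , refl , Vec.here
∈-inject≤-subset⁻ (b ∷ S) (s≤s m≤n) (Vec.there x∈) with x′ , refl , x′∈S ← ∈-inject≤-subset⁻ S m≤n x∈ =
  Fin.suc x′ , refl , Vec.there x′∈S

restrict : ∀ {m n} → m ≤ n → Graph n → Graph m
restrict m≤n Γ = record
  { adj    = λ i j → adj (Fin.inject≤ i m≤n) (Fin.inject≤ j m≤n)
  ; sym    = λ i j → adj-sym (Fin.inject≤ i m≤n) (Fin.inject≤ j m≤n)
  ; irrefl = λ i → irrefl (Fin.inject≤ i m≤n)
  }
  where open Graph Γ renaming (sym to adj-sym)

ramseyProperty-mono : ∀ {k m n} → m ≤ n → RamseyProperty k m → RamseyProperty k n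
ramseyProperty-mono m≤n ramsey Γ with b , S , ∣S∣≡k , hom ← ramsey (restrict m≤n Γ) =
  b , inject≤-subset S m≤n , trans (∣inject≤-subset∣ S m≤n) ∣S∣≡k , hom′
  where
  hom′ : Homogeneous Γ b (inject≤-subset S m≤n)
  hom′ i j i∈ j∈ i≢j
    with i′ , refl , i′∈S ← ∈-inject≤-subset⁻ S m≤n i∈ | j′ , refl , j′∈S ← ∈-inject≤-subset⁻ S m≤n j∈ =
    hom i′ j′ i′∈S j′∈S (i≢j ∘ cong (λ x → Fin.inject≤ x m≤n))

ramseyProperty⇔≥ramseyNumber : ∀ {k r n} → IsRamseyNumber k r → 1 ≤ n → RamseyProperty k n ⇔ r ≤ n
ramseyProperty⇔≥ramseyNumber {n = n} (_ , ramsey-r , minimal) 1≤n =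
  mk⇔ (minimal n 1≤n) (λ r≤n → ramseyProperty-mono r≤n ramsey-r)

Q-root⇔noMonochromaticFreeColouring : ∀ n k → 2 ≤ k →
  (Q n k (1ℤ - (+ 2) ^ (k C 2 ∸ 1)) ≡ 0ℤ) ⇔ All (¬_ ∘ MonochromaticFree k) (sublists (choose n 2))
Q-root⇔noMonochromaticFreeColouring n k 2≤k = begin
  Q n k t₀ ≡ 0ℤ                                             ≈⟨ *≡*⇒≡0⇔≡0 2^K*2^E≢0 c^K≢0 identity ⟩
  ∑[ G ∈ sublists E ] ⟦ monochromaticFree? k G ⟧ ≡ 0ℤ       ≈⟨ ∑⟦⟧≡0⇔All¬ (monochromaticFree? k) (sublists E) ⟩
  All (¬_ ∘ MonochromaticFree k) (sublists E)               ∎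
  where
  open SetoidReasoning (⇔-setoid 0ℓ)
  K = choose n k
  E = choose n 2
  m = k C 2 ∸ 1
  t₀ = 1ℤ - (+ 2) ^ m
  identity : (+ 2) ^ length K * (+ 2) ^ length E * Q n k t₀
             ≡ (- ((+ 2) ^ suc m)) ^ length K * ∑[ G ∈ sublists E ] ⟦ monochromaticFree? k G ⟧
  identity = trans (ℤ.*-assoc ((+ 2) ^ length K) ((+ 2) ^ length E) (Q n k t₀))
                   (Q-at-1-2^m n k m (length-pairsIn 2≤k))
  2^K*2^E≢0 = *≢0 (^≢0 (length K) 2≢0) (^≢0 (length E) 2≢0)
  c^K≢0 = ^≢0 (length K) (-≢0 (^≢0 (suc m) 2≢0))

corollary2p6 : (n k : ℕ) → 2 ≤ k → k ≤ n → (r : ℕ) → IsRamseyNumber k r →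
    (Q n k (1ℤ - (+ 2) ^ ((k C 2) ∸ 1)) ≡ 0ℤ) ⇔ (r ≤ n)
corollary2p6 n k 2≤k k≤n r r≡R[k] = begin
  Q n k (1ℤ - (+ 2) ^ (k C 2 ∸ 1)) ≡ 0ℤ                  ≈⟨ Q-root⇔noMonochromaticFreeColouring n k 2≤k ⟩
  All (¬_ ∘ MonochromaticFree k) (sublists (choose n 2))  ≈⟨ ramsey⇔noMonochromaticFreeColouring ⟨
  RamseyProperty k n                                      ≈⟨ ramseyProperty⇔≥ramseyNumber r≡R[k] 1≤n ⟩
  r ≤ n                                                   ∎
  where
  open SetoidReasoning (⇔-setoid 0ℓ)
  1≤n : 1 ≤ n
  1≤n = ℕ.≤-trans (s≤s z≤n) (ℕ.≤-trans 2≤k k≤n)
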